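{- Let $u\in A^*\setminus A$ with $w(N(u,A))\geq\delta^{ -1}w(u)$. Then \[\sum_{v\in A}\mathrm{contr}(u,v)-2\,\mathrm{charge}(u,n_1(u))\geq(1-2\delta)\cdot w(\mathrm{supp}(u)).\]
   Context: Let $k\geq 3$ be an integer and $G=(V,E)$ a finite simple $(k+1)$-claw free graph (no vertex has $k+1$ pairwise non-adjacent neighbors) with weights $w:V\to\mathbb{Q}_{>0}$; $w(X)=\sum_{x\in X}w(x)$, $w^2(X)=\sum_{x\in X}w(x)^2$. Let $A^*$ be a maximum-weight independent set and $A$ an independent set. $N(X,A)=(X\cap A)\cup\{a\in A:a\text{ adjacent to some }x\in X\}$, $N(u,A)=N(\{u\},A)$. An independent $X$ is a local improvement if $w^2(X)>w^2(N(X,A))$; it is claw-shaped if $|X|=1$ and $N(X,A)=\emptyset$, or some $v\in A$ is adjacent to all of $X$. Assume no claw-shaped improvement of $A$ exists. Fix $\sigma\in(0,1)$ and set $\delta=\sigma/4$, $\alpha=\delta^{ -2}$, $\beta=\delta$, $m=\lceil\delta^{ -3}\rceil$. For $u\in V$ order $N(u,A)$ by non-increasing weight and let $n_i(u)$ be its $i$-th element. $\mathrm{contr}(u,v)=\max\{0,(w(u)^2-w^2(N(u,A)\setminus\{v\}))/w(v)\}$ if $v\in N(u,A)$, else $0$; $\mathrm{charge}(u,v)=w(u)-\frac12w(N(u,A))$ if $v=n_1(u)$, else $0$. For $u\in V\setminus A$ let $i^u_{end}=\min\{|N(u,A)|+1,\,m+1,\,\min\{i\leq|N(u,A)|: w(n_i(u))\notin[\alpha^{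 -1}w(u),\alpha w(u)]\}\}$ (with $\min\emptyset=\infty$); $\mathrm{help}(u)=\{n_i(u):1\leq i<i^u_{end}\}$ if $w^2(\{n_i(u):i^u_{end}\leq i\leq|N(u,A)|\})\leq\beta w(u)^2$, and $\mathrm{help}(u)=\emptyset$ otherwise. $\mathrm{supp}(u)=N(u,A)\setminus\mathrm{help}(u)$.
   Formalization: The parameter σ ranges over the rationals in (0,1), so δ, α and β are rational as well. -}

module Defs where

open import Data.Bool using (Bool; true; false; if_then_else_; _∧_; _∨_; not)
open import Data.Nat as ℕ using (ℕ; zero; suc)
open import Data.Fin as Fin using (Fin)
open import Data.List using (List; []; _∷_; take; drop; head)
open import Data.Maybe using (Maybe; just; nothing)
open import Data.Integer as ℤ using (ℤ)
open import Data.Rational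
open import Data.Rational.Properties using (pos⇒nonZero; pos*pos⇒pos)
open import Data.Product using (Σ; _×_; _,_)
open import Relation.Binary.PropositionalEquality using (_≡_; _≢_)
open import Relation.Nullary using (¬_)
open import Relation.Nullary.Decidable using () renaming (⌊_⌋ to isYes)
open import Function.Definitions using (Injective)

record Graph (n : ℕ) : Set where
  field
    adj    : Fin n → Fin n → Bool
    sym    : ∀ x y → adj x y ≡ adj y x
    irrefl : ∀ x → adj x x ≡ false
open Graph public

VSet : ℕ → Set
VSet n = Fin n → Bool

∑ : ∀ {n} → (Fin n → ℚ) → ℚ
∑ {zero}  f = 0ℚ
∑ {suc n} f = f Fin.zero + ∑ (λ i → f (Fin.suc i))

anyFin : ∀ {n} → (Fin n → Bool) → Bool
anyFin {zero}  f = false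
anyFin {suc n} f = f Fin.zero ∨ anyFin (λ i → f (Fin.suc i))

card : ∀ {n} → VSet n → ℕ
card {zero}  X = 0
card {suc n} X = (if X Fin.zero then 1 else 0) ℕ.+ card (λ i → X (Fin.suc i))

wt : ∀ {n} → (Fin n → ℚ) → VSet n → ℚ
wt w X = ∑ (λ x → if X x then w x else 0ℚ)

wt² : ∀ {n} → (Fin n → ℚ) → VSet n → ℚ
wt² w X = ∑ (λ x → if X x then w x * w x else 0ℚ)

wtL² : ∀ {n} → (Fin n → ℚ) → List (Fin n) → ℚ
wtL² w []       = 0ℚ
wtL² w (x ∷ xs) = w x * w x + wtL² w xs

elemL : ∀ {n} → Fin n → List (Fin n) → Bool
elemL x []       = false
elemL x (y ∷ ys) = isYes (x Fin.≟ y) ∨ elemL x ys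

singleton : ∀ {n} → Fin n → VSet n
singleton u x = isYes (x Fin.≟ u)

Independent : ∀ {n} → Graph n → VSet n → Set
Independent G X = ∀ x y → X x ≡ true → X y ≡ true → adj G x y ≡ false

-- (k+1)-claw free: no vertex has k+1 pairwise non-adjacent (distinct) neighbours
ClawFree : ∀ {n} → ℕ → Graph n → Set
ClawFree k G = ∀ (v : Fin _) (f : Fin (suc k) → Fin _) →
  Injective _≡_ _≡_ f →
  (∀ i → adj G v (f i) ≡ true) →
  ¬ (∀ i j → i ≢ j → adj G (f i) (f j) ≡ false)

MaxWeightIndep : ∀ {n} → Graph n → (Fin n → ℚ) → VSet n → Set
MaxWeightIndep G w S = Independent G S × (∀ T → Independent G T → wt w T ≤ wt w S)

Nb : ∀ {n} → Graph n → VSet n → VSet n → VSet n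
Nb G X A a = A a ∧ (X a ∨ anyFin (λ x → X x ∧ adj G x a))

ClawShaped : ∀ {n} → Graph n → VSet n → VSet n → Set
ClawShaped G A X =
  (card X ≡ 1 × (∀ a → Nb G X A a ≡ false))
  ⊎' (Σ (Fin _) λ v → A v ≡ true × (∀ x → X x ≡ true → adj G v x ≡ true))
  where
  open import Data.Sum renaming (_⊎_ to _⊎'_)

LocalImprovement : ∀ {n} → Graph n → (Fin n → ℚ) → VSet n → VSet n → Set
LocalImprovement G w A X = Independent G X × (wt² w X > wt² w (Nb G X A))

NoClawShapedImprovement : ∀ {n} → Graph n → (Fin n → ℚ) → VSet n → Set
NoClawShapedImprovement G w A =
  ∀ X → ClawShaped G A X → ¬ LocalImprovement G w A X

δ : ℚ → ℚ
δ σ = σ * (ℤ.+ 1 / 4)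

δ-pos : ∀ σ → .{{Positive σ}} → Positive (δ σ)
δ-pos σ = pos*pos⇒pos σ (ℤ.+ 1 / 4)

δ⁻¹ : (σ : ℚ) → .{{Positive σ}} → ℚ
δ⁻¹ σ = (1/ δ σ) {{pos⇒nonZero (δ σ) {{δ-pos σ}}}}

α : (σ : ℚ) → .{{Positive σ}} → ℚ
α σ = δ⁻¹ σ * δ⁻¹ σ

α⁻¹ : (σ : ℚ) → .{{Positive σ}} → ℚ
α⁻¹ σ = δ σ * δ σ

β : ℚ → ℚ
β σ = δ σ

m : (σ : ℚ) → .{{Positive σ}} → ℕ
m σ = ℤ.∣ ⌈ δ⁻¹ σ * δ⁻¹ σ * δ⁻¹ σ ⌉ ∣

-- help / supp, relative to an ordering `ord` of N(u,A) by non-increasing weight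
-- (ord lists n₁(u), n₂(u), … ; see Statement)

InRange : ℚ → ℚ → ℚ → Bool
InRange lo hi x = (lo ≤ᵇ x) ∧ (x ≤ᵇ hi)

goodPrefix : ∀ {n} → (Fin n → ℚ) → ℚ → ℚ → ℕ → List (Fin n) → ℕ
goodPrefix w lo hi zero    xs       = 0
goodPrefix w lo hi (suc c) []       = 0
goodPrefix w lo hi (suc c) (x ∷ xs) =
  if InRange lo hi (w x) then suc (goodPrefix w lo hi c xs) else 0

iEnd-1 : ∀ {n} → (σ : ℚ) → .{{Positive σ}} → (Fin n → ℚ) → Fin n → List (Fin n) → ℕ
iEnd-1 σ w u ord = goodPrefix w (α⁻¹ σ * w u) (α σ * w u) (m σ) ord

helpL : ∀ {n} → (σ : ℚ) → .{{Positive σ}} → (Fin n → ℚ) → Fin n → List (Fin n) → List (Fin n)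
helpL σ w u ord =
  if wtL² w (drop (iEnd-1 σ w u ord) ord) ≤ᵇ β σ * (w u * w u)
  then take (iEnd-1 σ w u ord) ord
  else []

supp : ∀ {n} → (σ : ℚ) → .{{Positive σ}} → Graph n → (Fin n → ℚ) → VSet n →
       Fin n → List (Fin n) → VSet n
supp σ G w A u ord x = Nb G (singleton u) A x ∧ not (elemL x (helpL σ w u ord))

contr : ∀ {n} → Graph n → (w : Fin n → ℚ) → (∀ x → Positive (w x)) → VSet n →
        Fin n → Fin n → ℚ
contr G w wpos A u v =
  if Nb G (singleton u) A v
  then 0ℚ ⊔ ((w u * w u - wt² w (λ x → Nb G (singleton u) A x ∧ not (isYes (x Fin.≟ v))))
             ÷ w v) {{pos⇒nonZero (w v) {{wpos v}}}}
  else 0ℚ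

charge : ∀ {n} → Graph n → (Fin n → ℚ) → VSet n → Fin n → List (Fin n) → Fin n → ℚ
charge G w A u ord v with head ord
... | just n₁ = if isYes (v Fin.≟ n₁) then w u - ½ * wt w (Nb G (singleton u) A) else 0ℚ
... | nothing = 0ℚ

{-# OPTIONS --safe #-}
-- Write W = w(N(u,A)). The charge of u is w(u) − ½W and the hypothesis says w(u) ≤ δW, so twice the
-- charge is at most (2δ − 1)W. Contributions are non-negative and supp(u) ⊆ N(u,A), hence the
-- left-hand side is at least (1 − 2δ)W ≥ (1 − 2δ) w(supp(u)).
module Submission where

open import Defs
open import Data.Bool using (true; false; if_then_else_)
open import Data.Nat as ℕ using (ℕ)
open import Data.Fin using (Fin)
open import Data.List using (List; head)
open import Data.Maybe using (just)
open import Data.Rational using (ℚ; 0ℚ; 1ℚ; Positive; _*_; _+_; _-_; _≤_; _<_; _≥_)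
open import Data.Product using (_×_)
open import Data.List.Membership.Propositional using (_∈_)
open import Data.List.Relation.Unary.Unique.Propositional using (Unique)
open import Data.List.Relation.Unary.Linked using (Linked)
open import Relation.Binary.PropositionalEquality using (_≡_)

open import Data.Bool using (not; _∧_)
open import Data.Bool.Properties using (∧-conicalˡ)
open import Data.Fin as Fin using ()
open import Data.List using (_∷_)
open import Data.Integer as ℤ using ()
open import Data.Rational using (nonNegative; -_; ½; _/_; _÷_)
open import Data.Rational.Properties
open import Data.Rational.Solver using (module +-*-Solver)
open import Relation.Binary.PropositionalEquality using (refl; trans; cong; module ≡-Reasoning) renaming (sym to ≡-sym)
open import Relation.Nullary using (yes; no)
open import Relation.Nullary.Decidable using (toWitness) renaming (⌊_⌋ to isYes)
open import Data.Empty using (⊥-elim)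

∑-nonNeg : ∀ {n} (f : Fin n → ℚ) → (∀ x → 0ℚ ≤ f x) → 0ℚ ≤ ∑ f
∑-nonNeg {ℕ.zero}  f f≥0 = ≤-refl
∑-nonNeg {ℕ.suc n} f f≥0 =
  +-mono-≤ (f≥0 Fin.zero) (∑-nonNeg (λ i → f (Fin.suc i)) (λ i → f≥0 (Fin.suc i)))

∑-mono-≤ : ∀ {n} (f g : Fin n → ℚ) → (∀ x → f x ≤ g x) → ∑ f ≤ ∑ g
∑-mono-≤ {ℕ.zero}  f g f≤g = ≤-refl
∑-mono-≤ {ℕ.suc n} f g f≤g =
  +-mono-≤ (f≤g Fin.zero) (∑-mono-≤ (λ i → f (Fin.suc i)) (λ i → g (Fin.suc i)) (λ i → f≤g (Fin.suc i)))

wt-mono-⊆ : ∀ {n} (w : Fin n → ℚ) → (∀ x → 0ℚ ≤ w x) → (X Y : VSet n) →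
            (∀ x → X x ≡ true → Y x ≡ true) → wt w X ≤ wt w Y
wt-mono-⊆ w w≥0 X Y X⊆Y = ∑-mono-≤ _ _ pointwise
  where
  pointwise : ∀ x → (if X x then w x else 0ℚ) ≤ (if Y x then w x else 0ℚ)
  pointwise x with X x in Xx | Y x in Yx
  ... | false | false = ≤-refl
  ... | false | true  = w≥0 x
  ... | true  | true  = ≤-refl
  ... | true  | false with () ← trans (≡-sym (X⊆Y x Xx)) Yx

if-nonNeg : ∀ b {p} → 0ℚ ≤ p → 0ℚ ≤ (if b then p else 0ℚ)
if-nonNeg false p≥0 = ≤-refl
if-nonNeg true  p≥0 = p≥0

supp⊆Nb : ∀ {n} (σ : ℚ) .{{_ : Positive σ}} (G : Graph n) (w : Fin n → ℚ) (A : VSet n) u ord x →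
          supp σ G w A u ord x ≡ true → Nb G (singleton u) A x ≡ true
supp⊆Nb σ G w A u ord x = ∧-conicalˡ _ _

contr-nonNeg : ∀ {n} (G : Graph n) (w : Fin n → ℚ) (wpos : ∀ x → Positive (w x)) (A : VSet n) u v →
               0ℚ ≤ contr G w wpos A u v
contr-nonNeg G w wpos A u v with Nb G (singleton u) A v
... | false = ≤-refl
... | true  = p≤p⊔q 0ℚ ((w u * w u - wt² w (λ x → Nb G (singleton u) A x ∧ not (isYes (x Fin.≟ v)))) ÷ w v)
  where instance _ = pos⇒nonZero (w v) {{wpos v}}

charge-head : ∀ {n} (G : Graph n) (w : Fin n → ℚ) (A : VSet n) u ord n₁ → head ord ≡ just n₁ →
              charge G w A u ord n₁ ≡ w u - ½ * wt w (Nb G (singleton u) A)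
charge-head G w A u (n₁ ∷ _) n₁ refl with n₁ Fin.≟ n₁
... | yes _   = refl
... | no n₁≢n₁ = ⊥-elim (n₁≢n₁ refl)

δ*δ⁻¹* : ∀ σ .{{_ : Positive σ}} p → δ σ * (δ⁻¹ σ * p) ≡ p
δ*δ⁻¹* σ p = begin
  δ σ * (δ⁻¹ σ * p) ≡⟨ ≡-sym (*-assoc (δ σ) (δ⁻¹ σ) p) ⟩
  δ σ * δ⁻¹ σ * p   ≡⟨ cong (_* p) (*-inverseʳ (δ σ) {{pos⇒nonZero (δ σ) {{δ-pos σ}}}}) ⟩
  1ℚ * p            ≡⟨ *-identityˡ p ⟩
  p                 ∎
  where open ≡-Reasoning

p≤q⇒0≤q-p : ∀ {p q} → p ≤ q → 0ℚ ≤ q - p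
p≤q⇒0≤q-p {p} {q} p≤q = ≤-trans (≤-reflexive (≡-sym (+-inverseʳ p))) (+-monoˡ-≤ (- p) p≤q)

1-2δ-nonNeg : ∀ σ .{{_ : Positive σ}} → σ ≤ 1ℚ → 0ℚ ≤ 1ℚ - (1ℚ + 1ℚ) * δ σ
1-2δ-nonNeg σ σ≤1 = p≤q⇒0≤q-p (begin
  (1ℚ + 1ℚ) * δ σ                ≤⟨ *-monoˡ-≤-nonNeg (1ℚ + 1ℚ) (*-monoʳ-≤-nonNeg (ℤ.+ 1 / 4) σ≤1) ⟩
  (1ℚ + 1ℚ) * (1ℚ * (ℤ.+ 1 / 4)) ≤⟨ toWitness {a? = (1ℚ + 1ℚ) * (1ℚ * (ℤ.+ 1 / 4)) ≤? 1ℚ} _ ⟩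
  1ℚ                             ∎)
  where open ≤-Reasoning

[1-2d]W≤C-2[U-½W] : ∀ C U W d → 0ℚ ≤ C → U ≤ d * W →
                    (1ℚ - (1ℚ + 1ℚ) * d) * W ≤ C - (1ℚ + 1ℚ) * (U - ½ * W)
[1-2d]W≤C-2[U-½W] C U W d C≥0 U≤dW = begin
  (1ℚ - 2ℚ * d) * W       ≡⟨ solve 2 (λ d W → (con 1ℚ :- con 2ℚ :* d) :* W
                                           := con 0ℚ :+ (W :- con 2ℚ :* (d :* W))) refl d W ⟩
  0ℚ + (W - 2ℚ * (d * W)) ≤⟨ +-mono-≤ C≥0 (+-monoʳ-≤ W (neg-antimono-≤ (*-monoˡ-≤-nonNeg 2ℚ U≤dW))) ⟩
  C + (W - 2ℚ * U)        ≡⟨ solve 3 (λ C U W → C :+ (W :- con 2ℚ :* U)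
                                           := C :- con 2ℚ :* (U :- con ½ :* W)) refl C U W ⟩
  C - 2ℚ * (U - ½ * W)    ∎
  where
  open ≤-Reasoning
  open +-*-Solver
  2ℚ : ℚ
  2ℚ = 1ℚ + 1ℚ

lemma19 : (k : ℕ) → 3 ℕ.≤ k →
    {n : ℕ} (G : Graph n) → ClawFree k G →
    (w : Fin n → ℚ) (wpos : ∀ x → Positive (w x)) →
    (A* A : VSet n) → MaxWeightIndep G w A* → Independent G A →
    NoClawShapedImprovement G w A →
    (σ : ℚ) .{{_ : Positive σ}} → σ < 1ℚ →
    (u : Fin n) →
    -- ord = (n₁(u), n₂(u), …): N(u,A) listed by non-increasing weight
    (ord : List (Fin n)) →
    Unique ord →
    (∀ x → (x ∈ ord → Nb G (singleton u) A x ≡ true) × (Nb G (singleton u) A x ≡ true → x ∈ ord)) →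
    Linked (λ a b → w b ≤ w a) ord →
    A* u ≡ true → A u ≡ false →
    wt w (Nb G (singleton u) A) ≥ δ⁻¹ σ * w u →
    ∀ n₁ → head ord ≡ just n₁ →
    ∑ (λ v → if A v then contr G w wpos A u v else 0ℚ)
      - (1ℚ + 1ℚ) * charge G w A u ord n₁
      ≥ (1ℚ - (1ℚ + 1ℚ) * δ σ) * wt w (supp σ G w A u ord)
lemma19 _ _ G _ w wpos _ A _ _ _ σ σ<1 u ord _ _ _ _ _ W≥δ⁻¹wu n₁ ord≡n₁∷ =
  begin
    (1ℚ - 2δ) * wt w (supp σ G w A u ord) ≤⟨ *-monoˡ-≤-nonNeg (1ℚ - 2δ) {{nonNegative (1-2δ-nonNeg σ (<⇒≤ σ<1))}}
                                               (wt-mono-⊆ w w≥0 _ _ (supp⊆Nb σ G w A u ord)) ⟩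
    (1ℚ - 2δ) * W                         ≤⟨ [1-2d]W≤C-2[U-½W] C (w u) W (δ σ) C≥0 wu≤δW ⟩
    C - 2ℚ * (w u - ½ * W)                ≡⟨ cong (λ h → C - 2ℚ * h) (≡-sym (charge-head G w A u ord n₁ ord≡n₁∷)) ⟩
    C - 2ℚ * charge G w A u ord n₁        ∎
  where
  open ≤-Reasoning
  2ℚ 2δ W C : ℚ
  2ℚ = 1ℚ + 1ℚ
  2δ = 2ℚ * δ σ
  W = wt w (Nb G (singleton u) A)
  C = ∑ (λ v → if A v then contr G w wpos A u v else 0ℚ)
  C≥0 : 0ℚ ≤ C
  C≥0 = ∑-nonNeg _ λ v → if-nonNeg (A v) (contr-nonNeg G w wpos A u v)
  w≥0 : ∀ x → 0ℚ ≤ w x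
  w≥0 x = <⇒≤ (positive⁻¹ (w x) {{wpos x}})
  wu≤δW : w u ≤ δ σ * W
  wu≤δW = ≤-trans (≤-reflexive (≡-sym (δ*δ⁻¹* σ (w u))))
                  (*-monoˡ-≤-nonNeg (δ σ) {{pos⇒nonNeg (δ σ) {{δ-pos σ}}}} W≥δ⁻¹wu)
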